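{- For every positive integer $k$ and every graph $G$, if $G$ contains $B_k$ as a minor, then $\chi_{\mathrm{lin}}(G) \geq k/\log 3$.
   Context: All graphs are finite and simple; logarithms are binary. $B_k$ denotes the complete binary tree with $k$ levels. A linear coloring of a graph $G$ is an assignment of integers (colors) to its vertices such that every path of $G$ (as a subgraph) contains a vertex whose color appears exactly once on that path; $\chi_{\mathrm{lin}}(G)$ is the minimum number of colors in a linear coloring of $G$. -}

module Defs where

open import Level using (0ℓ)
open import Data.Nat using (ℕ; zero; suc; _+_; _*_; _∸_; _^_; _≤_)
open import Data.Fin using (Fin; toℕ; _≟_)
open import Data.Maybe using (Maybe; just)
open import Data.List using (List; []; _∷_; length; filter)
open import Data.List.Membership.Propositional using (_∈_)
open import Data.List.Relation.Unary.Unique.Propositional using (Unique)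
open import Data.List.Relation.Unary.Linked using (Linked)
open import Data.Product using (Σ; ∃; _×_; _,_)
open import Data.Sum using (_⊎_)
open import Relation.Nullary using (¬_)
open import Relation.Binary.PropositionalEquality using (_≡_)

record Graph : Set₁ where
  field
    n      : ℕ
    Adj    : Fin n → Fin n → Set
    sym    : ∀ {u v} → Adj u v → Adj v u
    irrefl : ∀ {u} → ¬ Adj u u
open Graph public

record IsPath (G : Graph) (p : List (Fin (n G))) : Set where
  field
    nonempty : ¬ (p ≡ [])
    distinct : Unique p
    linked   : Linked (Adj G) p

occurrences : {N m : ℕ} → (Fin N → Fin m) → List (Fin N) → Fin m → ℕ
occurrences c p col = length (filter (λ v → c v ≟ col) p)

IsLinearColoring : (G : Graph) (m : ℕ) → (Fin (n G) → Fin m) → Set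
IsLinearColoring G m c =
  (p : List (Fin (n G))) → IsPath G p →
  ∃ λ x → x ∈ p × occurrences c p (c x) ≡ 1

HasLinearColoring : Graph → ℕ → Set
HasLinearColoring G m = ∃ λ (c : Fin (n G) → Fin m) → IsLinearColoring G m c

IsLinChromaticNumber : Graph → ℕ → Set
IsLinChromaticNumber G χ =
  HasLinearColoring G χ × (∀ m → HasLinearColoring G m → χ ≤ m)

data ReachIn (G : Graph) (P : Fin (n G) → Set) : Fin (n G) → Fin (n G) → Set where
  here : ∀ {x} → P x → ReachIn G P x x
  step : ∀ {x y z} → P x → Adj G x y → ReachIn G P y z → ReachIn G P x z

-- H is a minor of G: branch sets β⁻¹(just u) (disjoint by construction),
-- each non-empty and connected in G, and for every edge uv of H some edge
-- of G joins the branch sets of u and v.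
record MinorModel (H G : Graph) : Set where
  field
    β         : Fin (n G) → Maybe (Fin (n H))
    nonempty  : ∀ u → ∃ λ x → β x ≡ just u
    connected : ∀ u x y → β x ≡ just u → β y ≡ just u →
                ReachIn G (λ z → β z ≡ just u) x y
    edges     : ∀ u v → Adj H u v →
                ∃ λ x → ∃ λ y → β x ≡ just u × β y ≡ just v × Adj G x y

IsMinorOf : Graph → Graph → Set
IsMinorOf H G = MinorModel H G

-- Complete binary tree B_k with k levels: 2^k - 1 vertices in heap order,
-- vertex i (0-based) has children 2i+1 and 2i+2.
data TreeAdj (k : ℕ) (i j : Fin (2 ^ k ∸ 1)) : Set where
  child  : toℕ j ≡ 1 + 2 * toℕ i ⊎ toℕ j ≡ 2 + 2 * toℕ i → TreeAdj k i j
  parent : toℕ i ≡ 1 + 2 * toℕ j ⊎ toℕ i ≡ 2 + 2 * toℕ j → TreeAdj k i j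

private
  open import Data.Nat using (_<_; s≤s)
  open import Data.Nat.Properties using (m≤m+n; <-irrefl; m<n⇒m<1+n)
  open import Relation.Binary.PropositionalEquality as Eq using ()
  open import Data.Sum using (inj₁; inj₂)

  lt1 : ∀ m → m < 1 + 2 * m
  lt1 m = s≤s (m≤m+n m (m + 0))

  lemA : ∀ m → ¬ (m ≡ 1 + 2 * m)
  lemA m e = <-irrefl e (lt1 m)

  lemB : ∀ m → ¬ (m ≡ 2 + 2 * m)
  lemB m e = <-irrefl e (m<n⇒m<1+n (lt1 m))

B : ℕ → Graph
B k = record
  { n = 2 ^ k ∸ 1
  ; Adj = TreeAdj k
  ; sym = λ { (child p) → parent p ; (parent p) → child p }
  ; irrefl = irr
  }
  where
  irr : ∀ {u} → ¬ TreeAdj k u u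
  irr (child (inj₁ e))  = lemA _ e
  irr (child (inj₂ e))  = lemB _ e
  irr (parent (inj₁ e)) = lemA _ e
  irr (parent (inj₂ e)) = lemB _ e

{-# OPTIONS --safe #-}
module Submission where

-- For each of the 2^k direction sequences d₁ … d_k, walk through the branch sets of the
-- root-to-leaf path of B_k that they describe: inside a branch set, go from the entry vertex
-- to the centre of a tripod joining it to the exits towards both children, and on towards
-- child dᵢ; the centre is tagged dᵢ (in a leaf, the entry vertex is tagged d_k).  Two
-- different sequences give walks sharing a prefix and then leaving a common centre with
-- different tags along disjoint arms into different subtrees, so their two remainders
-- together with the centre form a path of G.  Weigh every vertex 1, except centres tagged
-- 1F, which weigh 2.  Some colour β occurs exactly once on that path, and then the
-- β-coloured weight of the two walks differs modulo 3.  So the residues modulo 3 of the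
-- coloured weights inject the 2^k sequences into the 3^χ maps from colours to residues.

open import Defs hiding (sym)

open import Data.Bool using (if_then_else_)
open import Data.Fin using (Fin; toℕ; fromℕ<; funToFin; finToFun; combine) renaming (_≟_ to _≟ᶠ_)
open import Data.Fin.Patterns using (0F; 1F)
open import Data.Fin.Properties
  using (toℕ≤pred[n]; toℕ-fromℕ<; toℕ-injective; injective⇒≤; funToFin-finToFin; finToFun-funToFin)
open import Data.List using (List; []; _∷_; _++_; [_]; _∷ʳ_; reverse; map; length; filter)
open import Data.List.Properties
  using (unfold-reverse; reverse-++; ++-assoc; filter-++; length-++; ∷ʳ-injectiveʳ; ++-cancelʳ;
         map-∘; map-id; map-++)
open import Data.List.Membership.Propositional using (_∈_; _∉_)
open import Data.List.Membership.Propositional.Properties using (∈-∃++; ∈-++⁺ˡ; ∈-++⁺ʳ; ∈-++⁻)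
open import Data.List.Membership.DecPropositional using () renaming (_∈?_ to member?)
open import Data.List.Relation.Binary.Disjoint.Propositional using (Disjoint)
open import Data.List.Relation.Binary.Permutation.Setoid using (↭-sym)
open import Data.List.Relation.Binary.Permutation.Setoid.Properties using (Unique-resp-↭; ↭-reverse)
import Data.List.Relation.Binary.Permutation.Propositional.Properties as Perm
open import Data.List.Relation.Unary.All as All using ([])
open import Data.List.Relation.Unary.All.Properties using (¬Any⇒All¬; ++⁻ˡ; ++⁻ʳ)
open import Data.List.Relation.Unary.Any using (here; there)
open import Data.List.Relation.Unary.Any.Properties using (reverse⁻)
import Data.List.Relation.Unary.First as First
open import Data.List.Relation.Unary.First.Properties using (toView)
open import Data.List.Relation.Unary.Linked using (Linked; [-]; _∷_)
open import Data.List.Relation.Unary.Unique.Propositional using (Unique; []; _∷_)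
import Data.List.Relation.Unary.Unique.Propositional.Properties as Unique
open import Data.Maybe using (just)
open import Data.Maybe.Properties using (just-injective)
open import Data.Nat using (ℕ; zero; suc; _+_; _*_; _∸_; _≤_; _<_; _^_; z≤n; s≤s; NonZero)
open import Data.Nat.DivMod using (_%_; _mod_; [m+kn]%n≡m%n; %-distribˡ-+)
open import Data.Nat.Properties
  using (+-assoc; +-comm; +-suc; +-identityʳ; suc-injective; m+n≡0⇒m≡0; m+n≡0⇒n≡0; *-cancelˡ-≡;
         even≢odd; m≢1+n+m; ≤-refl; ≤-trans; <⇒≤; m≤m+n; +-monoʳ-≤; +-monoˡ-≤; *-monoʳ-≤;
         ^-monoʳ-≤; m+n≤o⇒m≤o∸n; m^n>0; module ≤-Reasoning)
open import Data.Nat.Tactic.RingSolver using (solve-∀)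
open import Data.Product using (Σ; ∃; _×_; _,_; proj₁; proj₂)
open import Data.Sum using (_⊎_; inj₁; inj₂; swap; [_,_]′)
open import Data.Vec using (Vec; []; _∷_; tabulate; lookup)
open import Data.Vec.Properties using (lookup∘tabulate; ≡-dec)
open import Function using (_∘_)
open import Relation.Binary.PropositionalEquality
  using (_≡_; _≗_; refl; sym; trans; cong; cong₂; subst; subst₂; setoid; module ≡-Reasoning)
open import Relation.Nullary using (¬_; yes; no; does; contradiction)
open import Relation.Nullary.Decidable using (toSum)

Dir : Set
Dir = Fin 2

[m+x]%d≡[m+y]%d⇒x%d≡y%d : ∀ m x y d .{{_ : NonZero d}} → (m + x) % d ≡ (m + y) % d → x % d ≡ y % d
[m+x]%d≡[m+y]%d⇒x%d≡y%d m x y d@(suc d′) eq = begin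
  x % d                          ≡⟨ shift x ⟩
  ((m + x) % d + m * d′ % d) % d ≡⟨ cong (λ r → (r + m * d′ % d) % d) eq ⟩
  ((m + y) % d + m * d′ % d) % d ≡⟨ shift y ⟨
  y % d                          ∎
  where
  open ≡-Reasoning
  rearrange : ∀ z m d′ → z + m * suc d′ ≡ (m + z) + m * d′
  rearrange = solve-∀
  shift : ∀ z → z % d ≡ ((m + z) % d + m * d′ % d) % d
  shift z = begin
    z % d                           ≡⟨ [m+kn]%n≡m%n z m d ⟨
    (z + m * d) % d                 ≡⟨ cong (_% d) (rearrange z m d′) ⟩
    ((m + z) + m * d′) % d          ≡⟨ %-distribˡ-+ (m + z) (m * d′) d ⟩
    ((m + z) % d + m * d′ % d) % d  ∎

m+n≡1-split : ∀ m n → m + n ≡ 1 → (m ≡ 1 × n ≡ 0) ⊎ (m ≡ 0 × n ≡ 1)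
m+n≡1-split zero          n       eq = inj₂ (refl , eq)
m+n≡1-split (suc zero)    zero    eq = inj₁ (refl , refl)
m+n≡1-split (suc zero)    (suc _) ()
m+n≡1-split (suc (suc _)) _       ()

module _ {A : Set} where

  Unique-++⁻ʳ : ∀ (xs : List A) {ys} → Unique (xs ++ ys) → Unique ys
  Unique-++⁻ʳ []       u       = u
  Unique-++⁻ʳ (x ∷ xs) (_ ∷ u) = Unique-++⁻ʳ xs u

  Unique-++⁻ˡ : ∀ (xs : List A) {ys} → Unique (xs ++ ys) → Unique xs
  Unique-++⁻ˡ []       u        = []
  Unique-++⁻ˡ (x ∷ xs) (x∉ ∷ u) = ++⁻ˡ xs x∉ ∷ Unique-++⁻ˡ xs u

  Unique-++⇒Disjoint : ∀ (xs : List A) {ys} → Unique (xs ++ ys) → Disjoint xs ys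
  Unique-++⇒Disjoint (x ∷ xs) (x∉ ∷ _) (here refl , v∈ys) = All.lookup (++⁻ʳ xs x∉) v∈ys refl
  Unique-++⇒Disjoint (x ∷ xs) (_ ∷ u)  (there v∈xs , v∈ys) = Unique-++⇒Disjoint xs u (v∈xs , v∈ys)

  Unique-reverse : ∀ {xs : List A} → Unique xs → Unique (reverse xs)
  Unique-reverse {xs} = Unique-resp-↭ (setoid A) (↭-sym (setoid A) (↭-reverse (setoid A) xs))

module _ {N m : ℕ} (c : Fin N → Fin m) (col : Fin m) where

  occurrences-++ : ∀ xs ys → occurrences c (xs ++ ys) col ≡ occurrences c xs col + occurrences c ys col
  occurrences-++ xs ys = trans (cong length (filter-++ _ xs ys)) (length-++ (filter _ xs))

  occurrences-reverse : ∀ xs → occurrences c (reverse xs) col ≡ occurrences c xs col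
  occurrences-reverse xs = Perm.↭-length (Perm.filter-↭ _ (Perm.↭-reverse xs))

module Walks (G : Graph) where

  Vertex : Set
  Vertex = Fin (n G)

  private variable
    a b c d x y z : Vertex
    xs ys : List Vertex
    P : Vertex → Set

  vertices : List (Vertex × Dir) → List Vertex
  vertices = map proj₁

  infixr 5 _◅_
  data Walk : Vertex → Vertex → List Vertex → Set where
    trivial : Walk x x [ x ]
    _◅_     : Adj G x y → Walk y z ys → Walk x z (x ∷ ys)

  Walk⇒Linked : Walk x y xs → Linked (Adj G) xs
  Walk⇒Linked trivial         = [-]
  Walk⇒Linked (e ◅ trivial)   = e ∷ [-]
  Walk⇒Linked (e ◅ w@(_ ◅ _)) = e ∷ Walk⇒Linked w

  last∈ : Walk x y xs → y ∈ xs
  last∈ trivial = here refl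
  last∈ (_ ◅ w) = there (last∈ w)

  head∈ : Walk x y xs → x ∈ xs
  head∈ trivial = here refl
  head∈ (_ ◅ _) = here refl

  append : Walk a b xs → Adj G b c → Walk c d ys → Walk a d (xs ++ ys)
  append trivial  e w = e ◅ w
  append (f ◅ v) e w = f ◅ append v e w

  reverseʷ : Walk x y xs → Walk y x (reverse xs)
  reverseʷ trivial = trivial
  reverseʷ {xs = x ∷ xs} (e ◅ w) =
    subst (Walk _ _) (sym (unfold-reverse x xs)) (append (reverseʷ w) (Graph.sym G e) trivial)

  suffix : ∀ xs → Walk a b (xs ++ z ∷ ys) → Walk z b (z ∷ ys)
  suffix []                trivial = trivial
  suffix []                (e ◅ w) = e ◅ w
  suffix (_ ∷ [])          (_ ◅ w) = suffix [] w
  suffix (_ ∷ xs@(_ ∷ _)) (_ ◅ w) = suffix xs w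

  prefix : ∀ xs → Walk a b (xs ++ z ∷ ys) → Walk a z (xs ∷ʳ z)
  prefix []                trivial = trivial
  prefix []                (_ ◅ _) = trivial
  prefix (_ ∷ [])          (e ◅ w) = e ◅ prefix [] w
  prefix (_ ∷ xs@(_ ∷ _)) (e ◅ w) = e ◅ prefix xs w

  glue : ∀ xs → Walk a z (xs ∷ʳ z) → Walk z b (z ∷ ys) → Walk a b (xs ++ z ∷ ys)
  glue []                trivial w = w
  glue (_ ∷ [])          (e ◅ v) w = e ◅ glue [] v w
  glue (_ ∷ xs@(_ ∷ _)) (e ◅ v) w = e ◅ glue xs v w

  record SimplePathIn (P : Vertex → Set) (x y : Vertex) (vs : List Vertex) : Set where
    field
      walk   : Walk x y vs
      unique : Unique vs
      inside : ∀ {v} → v ∈ vs → P v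

  ReachIn⇒SimplePathIn : ReachIn G P x y → ∃ (SimplePathIn P x y)
  ReachIn⇒SimplePathIn (here px) =
    [ _ ] , record { walk = trivial ; unique = [] ∷ [] ; inside = λ { (here refl) → px } }
  ReachIn⇒SimplePathIn {P} (step {x} px e r) with ReachIn⇒SimplePathIn r
  ... | vs , π with member? _≟ᶠ_ x vs
  ...   | no x∉ = x ∷ vs , record
    { walk   = e ◅ walk
    ; unique = ¬Any⇒All¬ vs x∉ ∷ unique
    ; inside = λ { (here refl) → px ; (there v∈) → inside v∈ }
    }
    where open SimplePathIn π
  ...   | yes x∈ = shortcut (∈-∃++ x∈) π
    where
    shortcut : ∀ {vs y} → Σ (List Vertex) (λ us → ∃ λ ws → vs ≡ us ++ x ∷ ws) →
               SimplePathIn P _ y vs → ∃ (SimplePathIn P x y)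
    shortcut (us , ws , refl) π = x ∷ ws , record
      { walk   = suffix us walk
      ; unique = Unique-++⁻ʳ us unique
      ; inside = inside ∘ ∈-++⁺ʳ us
      }
      where open SimplePathIn π

  ReachIn-mono : ∀ {Q} → (∀ {v} → P v → Q v) → ReachIn G P x y → ReachIn G Q x y
  ReachIn-mono P⊆Q (here px)       = here (P⊆Q px)
  ReachIn-mono P⊆Q (step px e r) = step (P⊆Q px) e (ReachIn-mono P⊆Q r)

  Connected : (Vertex → Set) → Set
  Connected P = ∀ {x y} → P x → P y → ReachIn G P x y

  firstMember : ∀ (qs ss : List Vertex) → x ∈ qs → x ∈ ss → First.FirstView (_∉ qs) (_∈ qs) ss
  firstMember qs ss x∈qs x∈ss with First.first (λ v → swap (toSum (member? _≟ᶠ_ v qs))) ss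
  ... | inj₁ first = toView first
  ... | inj₂ all∉  = contradiction x∈qs (All.lookup all∉ x∈ss)

  record Tripod (P : Vertex → Set) (p : Vertex) (target : Dir → Vertex) : Set where
    field
      stem          : List Vertex
      centre        : Vertex
      arm           : Dir → List Vertex
      walk          : ∀ d → Walk p (target d) (stem ++ centre ∷ arm d)
      unique        : ∀ d → Unique (stem ++ centre ∷ arm d)
      arms-disjoint : ∀ {d d′} → ¬ d ≡ d′ → Disjoint (arm d) (arm d′)
      inside        : ∀ d {v} → v ∈ stem ++ centre ∷ arm d → P v

  -- The centre is the first vertex, along a path from x to target 0F, of a path qs joining
  -- the two targets; the arms are the two pieces of qs beyond it.
  opaque
    tripod : ∀ {target} → Connected P → P x → (∀ d → P (target d)) → Tripod P x target
    tripod {P} {x} {target} conn px pt =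
      fromPaths (ReachIn⇒SimplePathIn (conn (pt 0F) (pt 1F))) (ReachIn⇒SimplePathIn (conn px (pt 0F)))
      where
      fromPaths : ∃ (SimplePathIn P (target 0F) (target 1F)) → ∃ (SimplePathIn P x (target 0F)) →
                  Tripod P x target
      fromPaths (qs , record { walk = wq ; unique = uq ; inside = iq })
                (ss , record { walk = ws ; unique = us ; inside = is })
        with firstMember qs ss (head∈ wq) (last∈ ws)
      ... | First._++_∷_ {stem} {z} stem∉qs z∈qs _ with ∈-∃++ z∈qs
      ...   | q₀ , q₁ , refl = record
        { stem = stem ; centre = z ; arm = arm ; walk = walk ; unique = unique
        ; arms-disjoint = arms-disjoint
        ; inside = inside
        }
        where
        arm : Dir → List Vertex
        arm 0F = reverse q₀
        arm 1F = q₁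

        armWalk : ∀ d → Walk z (target d) (z ∷ arm d)
        armWalk 0F = subst (Walk z _) (reverse-++ q₀ [ z ]) (reverseʷ (prefix q₀ wq))
        armWalk 1F = suffix q₀ wq

        armUnique : ∀ d → Unique (z ∷ arm d)
        armUnique 0F = subst Unique (reverse-++ q₀ [ z ])
          (Unique-reverse (Unique-++⁻ˡ (q₀ ∷ʳ z) (subst Unique (sym (++-assoc q₀ [ z ] q₁)) uq)))
        armUnique 1F = Unique-++⁻ʳ q₀ uq

        arms-disjoint : ∀ {d d′} → ¬ d ≡ d′ → Disjoint (arm d) (arm d′)
        arms-disjoint {0F} {0F} d≢d′ = contradiction refl d≢d′
        arms-disjoint {0F} {1F} _    (v∈₀ , v∈₁) = Unique-++⇒Disjoint q₀ uq (reverse⁻ {xs = q₀} v∈₀ , there v∈₁)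
        arms-disjoint {1F} {0F} _    (v∈₁ , v∈₀) = arms-disjoint {0F} {1F} (λ ()) (v∈₀ , v∈₁)
        arms-disjoint {1F} {1F} d≢d′ = contradiction refl d≢d′

        arm⊆qs : ∀ d {v} → v ∈ z ∷ arm d → v ∈ q₀ ++ z ∷ q₁
        arm⊆qs _  (here refl) = ∈-++⁺ʳ q₀ (here refl)
        arm⊆qs 0F (there v∈)  = ∈-++⁺ˡ (reverse⁻ {xs = q₀} v∈)
        arm⊆qs 1F (there v∈)  = ∈-++⁺ʳ q₀ (there v∈)

        walk : ∀ d → Walk x (target d) (stem ++ z ∷ arm d)
        walk d = glue stem (prefix stem ws) (armWalk d)

        unique : ∀ d → Unique (stem ++ z ∷ arm d)
        unique d = Unique.++⁺ (Unique-++⁻ˡ stem us) (armUnique d)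
          λ (v∈stem , v∈arm) → All.lookup stem∉qs v∈stem (arm⊆qs d v∈arm)

        inside : ∀ d {v} → v ∈ stem ++ z ∷ arm d → P v
        inside d v∈ with ∈-++⁻ stem v∈
        ... | inj₁ v∈stem = is (∈-++⁺ˡ v∈stem)
        ... | inj₂ v∈arm  = iq (arm⊆qs d v∈arm)

  Walk⇒nonempty : Walk x y xs → ¬ xs ≡ []
  Walk⇒nonempty trivial ()
  Walk⇒nonempty (_ ◅ _) ()

  Walk⇒IsPath : Walk x y xs → Unique xs → IsPath G xs
  Walk⇒IsPath w u = record { nonempty = Walk⇒nonempty w ; distinct = u ; linked = Walk⇒Linked w }

  fork-IsPath : Walk z x (z ∷ xs) → Walk z y (z ∷ ys) → Unique (z ∷ xs) → Unique (z ∷ ys) →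
                Disjoint xs ys → IsPath G (reverse xs ++ z ∷ ys)
  fork-IsPath {z} {xs = xs} wx wy (z∉xs ∷ ux) uy xs#ys = Walk⇒IsPath
    (glue (reverse xs) (subst (Walk _ z) (unfold-reverse z xs) (reverseʷ wx)) wy)
    (Unique.++⁺ (Unique-reverse ux) uy λ where
      (v∈xs , here refl) → All.lookup z∉xs (reverse⁻ v∈xs) refl
      (v∈xs , there v∈ys) → xs#ys (reverse⁻ v∈xs , v∈ys))

module Residues (G : Graph) {χ : ℕ} (c : Fin (n G) → Fin χ) where
  open Walks G using (Vertex; vertices)

  private variable
    β : Fin χ
    z : Vertex
    a b : Dir

  weight : Dir → ℕ
  weight d = suc (toℕ d)

  weight-residue-injective : weight a % 3 ≡ weight b % 3 → a ≡ b
  weight-residue-injective {0F} {0F} _ = refl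
  weight-residue-injective {0F} {1F} ()
  weight-residue-injective {1F} {0F} ()
  weight-residue-injective {1F} {1F} _ = refl

  weight-residue≢0 : ∀ d → ¬ weight d % 3 ≡ 0
  weight-residue≢0 0F ()
  weight-residue≢0 1F ()

  tally : Fin χ → List (Vertex × Dir) → ℕ
  tally β []             = 0
  tally β ((v , d) ∷ xs) = (if does (c v ≟ᶠ β) then weight d else 0) + tally β xs

  residue : Fin χ → List (Vertex × Dir) → ℕ
  residue β xs = tally β xs % 3

  colourCount : Fin χ → List (Vertex × Dir) → ℕ
  colourCount β xs = occurrences c (vertices xs) β

  tally-++ : ∀ β xs ys → tally β (xs ++ ys) ≡ tally β xs + tally β ys
  tally-++ β []             ys = refl
  tally-++ β ((v , d) ∷ xs) ys =
    trans (cong (_ +_) (tally-++ β xs ys)) (sym (+-assoc (if does (c v ≟ᶠ β) then weight d else 0) _ _))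

  residue-cancelˡ : ∀ β xs ys zs → residue β (xs ++ ys) ≡ residue β (xs ++ zs) →
                    residue β ys ≡ residue β zs
  residue-cancelˡ β xs ys zs eq = [m+x]%d≡[m+y]%d⇒x%d≡y%d (tally β xs) (tally β ys) (tally β zs) 3
    (subst₂ (λ s t → s % 3 ≡ t % 3) (tally-++ β xs ys) (tally-++ β xs zs) eq)

  tally-absent : ∀ xs → colourCount β xs ≡ 0 → tally β xs ≡ 0
  tally-absent []             _ = refl
  tally-absent {β} ((v , d) ∷ xs) none with c v ≟ᶠ β
  ... | no _ = tally-absent xs none

  weight+tally-absent : ∀ d xs → colourCount β xs ≡ 0 → weight d + tally β xs ≡ weight d
  weight+tally-absent d xs none = trans (cong (weight d +_) (tally-absent xs none)) (+-identityʳ (weight d))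

  tally-once : ∀ xs → colourCount β xs ≡ 1 → ∃ λ d → tally β xs ≡ weight d
  tally-once {β} ((v , d) ∷ xs) once with c v ≟ᶠ β
  ... | yes _ = d , weight+tally-absent d xs (suc-injective once)
  ... | no _  = tally-once xs once

  residue-once≢0 : ∀ xs → colourCount β xs ≡ 1 → ¬ residue β xs ≡ 0
  residue-once≢0 {β} xs once =
    let d , tally≡weight = tally-once xs once in weight-residue≢0 d ∘ subst (λ t → t % 3 ≡ 0) tally≡weight

  residues-differ : ∀ xs ys → ¬ a ≡ b → colourCount β xs + colourCount β ((z , b) ∷ ys) ≡ 1 →
                    ¬ residue β ((z , a) ∷ xs) ≡ residue β ((z , b) ∷ ys)
  residues-differ {a} {b} {β} {z} xs ys a≢b once with c z ≟ᶠ β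
  ... | yes _ = a≢b ∘ weight-residue-injective
              ∘ subst₂ (λ s t → s % 3 ≡ t % 3)
                  (weight+tally-absent a xs xs-none) (weight+tally-absent b ys ys-none)
    where
    none : colourCount β xs + colourCount β ys ≡ 0
    none = suc-injective (trans (sym (+-suc _ _)) once)
    xs-none = m+n≡0⇒m≡0 _ none
    ys-none = m+n≡0⇒n≡0 _ none
  ... | no _ with m+n≡1-split (colourCount β xs) (colourCount β ys) once
  ...   | inj₁ (xs-once , ys-none) rewrite tally-absent ys ys-none = residue-once≢0 xs xs-once
  ...   | inj₂ (xs-none , ys-once) rewrite tally-absent xs xs-none = residue-once≢0 ys ys-once ∘ sym

  linear-coloring-separates : IsLinearColoring G χ c → ∀ xs ys → ¬ a ≡ b →
             IsPath G (reverse (vertices xs) ++ z ∷ vertices ys) →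
             ∃ λ β → ¬ residue β ((z , a) ∷ xs) ≡ residue β ((z , b) ∷ ys)
  linear-coloring-separates {b = b} {z = z} linear xs ys a≢b path with linear _ path
  ... | x , _ , once = c x , residues-differ xs ys a≢b (begin
    colourCount (c x) xs + colourCount (c x) ((z , b) ∷ ys)
      ≡⟨ cong (_+ _) (occurrences-reverse c (c x) (vertices xs)) ⟨
    occurrences c (reverse (vertices xs)) (c x) + occurrences c (z ∷ vertices ys) (c x)
      ≡⟨ occurrences-++ c (c x) (reverse (vertices xs)) _ ⟨
    occurrences c (reverse (vertices xs) ++ z ∷ vertices ys) (c x)
      ≡⟨ once ⟩
    1 ∎)
    where open ≡-Reasoning

-- A node of B_k is addressed by the directions leading to it from the root, the last step
-- first, so that d ∷ ps is the child d of ps; heapIndex is its index in the heap order of B.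
Address : Set
Address = List Dir

heapIndex : Address → ℕ
heapIndex []       = 0
heapIndex (d ∷ ds) = suc (toℕ d + 2 * heapIndex ds)

heapIndex-injective : ∀ ps qs → heapIndex ps ≡ heapIndex qs → ps ≡ qs
heapIndex-injective []        []        _  = refl
heapIndex-injective (0F ∷ ps) (0F ∷ qs) eq =
  cong (0F ∷_) (heapIndex-injective ps qs (*-cancelˡ-≡ _ _ 2 (suc-injective eq)))
heapIndex-injective (1F ∷ ps) (1F ∷ qs) eq =
  cong (1F ∷_) (heapIndex-injective ps qs (*-cancelˡ-≡ _ _ 2 (suc-injective (suc-injective eq))))
heapIndex-injective (0F ∷ ps) (1F ∷ qs) eq =
  contradiction (suc-injective eq) (even≢odd (heapIndex ps) (heapIndex qs))
heapIndex-injective (1F ∷ ps) (0F ∷ qs) eq =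
  contradiction (sym (suc-injective eq)) (even≢odd (heapIndex qs) (heapIndex ps))

heapIndex-bound : ∀ ps → 2 + heapIndex ps ≤ 2 ^ suc (length ps)
heapIndex-bound []       = ≤-refl
heapIndex-bound (d ∷ ps) = begin
  3 + (toℕ d + 2 * heapIndex ps) ≤⟨ +-monoʳ-≤ 3 (+-monoˡ-≤ (2 * heapIndex ps) (toℕ≤pred[n] d)) ⟩
  3 + (1 + 2 * heapIndex ps)     ≡⟨ double (heapIndex ps) ⟩
  2 * (2 + heapIndex ps)         ≤⟨ *-monoʳ-≤ 2 (heapIndex-bound ps) ⟩
  2 * 2 ^ suc (length ps)        ∎
  where
  open ≤-Reasoning
  double : ∀ h → 3 + (1 + 2 * h) ≡ 2 * (2 + h)
  double = solve-∀

module Branches (G : Graph) (k : ℕ) (M : MinorModel (B k) G) where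
  open Walks G
  open MinorModel M

  private variable
    ps : Address
    d d′ : Dir
    v : Vertex

  node : (ps : Address) → length ps < k → Fin (2 ^ k ∸ 1)
  node ps fits = fromℕ< (m+n≤o⇒m≤o∸n (suc (heapIndex ps)) (begin
    suc (heapIndex ps) + 1     ≡⟨ +-comm (suc (heapIndex ps)) 1 ⟩
    2 + heapIndex ps           ≤⟨ heapIndex-bound ps ⟩
    2 ^ suc (length ps)        ≤⟨ ^-monoʳ-≤ 2 fits ⟩
    2 ^ k                      ∎))
    where open ≤-Reasoning

  toℕ-node : ∀ ps fits → toℕ (node ps fits) ≡ heapIndex ps
  toℕ-node ps fits = toℕ-fromℕ< _

  node-child : ∀ ps d fits fits′ → TreeAdj k (node ps fits) (node (d ∷ ps) fits′)
  node-child ps 0F fits fits′ =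
    child (inj₁ (trans (toℕ-node (0F ∷ ps) fits′) (cong (λ h → 1 + 2 * h) (sym (toℕ-node ps fits)))))
  node-child ps 1F fits fits′ =
    child (inj₂ (trans (toℕ-node (1F ∷ ps) fits′) (cong (λ h → 2 + 2 * h) (sym (toℕ-node ps fits)))))

  InBranch : Address → Vertex → Set
  InBranch ps v = ∃ λ u → β v ≡ just u × toℕ u ≡ heapIndex ps

  InBranch-node : ∀ ps fits → β v ≡ just (node ps fits) → InBranch ps v
  InBranch-node ps fits βv = node ps fits , βv , toℕ-node ps fits

  InBranch-injective : ∀ {qs} → InBranch ps v → InBranch qs v → ps ≡ qs
  InBranch-injective (u , βv , iu) (u′ , βv′ , iu′) = heapIndex-injective _ _
    (trans (sym iu) (trans (cong toℕ (just-injective (trans (sym βv) βv′))) iu′))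

  InBranch-connected : ∀ ps → Connected (InBranch ps)
  InBranch-connected ps (u , βx , iu) (u′ , βy , iu′) with toℕ-injective (trans iu (sym iu′))
  ... | refl = ReachIn-mono (λ βz → u , βz , iu) (connected u _ _ βx βy)

  InSubtree : Address → Vertex → Set
  InSubtree ps v = ∃ λ qs → InBranch (qs ++ ps) v

  InBranch⇒InSubtree : InBranch ps v → InSubtree ps v
  InBranch⇒InSubtree v∈ = [] , v∈

  InSubtree-parent : InSubtree (d ∷ ps) v → InSubtree ps v
  InSubtree-parent {d} {ps} {v} (qs , v∈) =
    qs ∷ʳ d , subst (λ as → InBranch as v) (sym (++-assoc qs [ d ] ps)) v∈

  InBranch⇒∉child-subtree : InBranch ps v → ¬ InSubtree (d ∷ ps) v
  InBranch⇒∉child-subtree {ps} v∈ (qs , v∈′) = m≢1+n+m (length ps)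
    (trans (cong length (InBranch-injective v∈ v∈′)) (trans (length-++ qs) (+-suc (length qs) (length ps))))

  child-subtrees-disjoint : ¬ d ≡ d′ → InSubtree (d ∷ ps) v → ¬ InSubtree (d′ ∷ ps) v
  child-subtrees-disjoint {d} {d′} {ps} d≢d′ (qs , v∈) (qs′ , v∈′) = d≢d′ (∷ʳ-injectiveʳ qs qs′
    (++-cancelʳ ps (qs ∷ʳ d) (qs′ ∷ʳ d′)
      (trans (++-assoc qs [ d ] ps) (trans (InBranch-injective v∈ v∈′) (sym (++-assoc qs′ [ d′ ] ps))))))

  record ChildEdge (ps : Address) (d : Dir) : Set where
    field
      exit     : Vertex
      entry    : Vertex
      exit∈    : InBranch ps exit
      entry∈   : InBranch (d ∷ ps) entry
      adjacent : Adj G exit entry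

  opaque
    childEdge : ∀ ps d → length (d ∷ ps) < k → ChildEdge ps d
    childEdge ps d fits with edges (node ps (<⇒≤ fits)) (node (d ∷ ps) fits) (node-child ps d (<⇒≤ fits) fits)
    ... | x , y , βx , βy , x~y = record
      { exit = x ; entry = y ; adjacent = x~y
      ; exit∈ = InBranch-node ps (<⇒≤ fits) βx ; entry∈ = InBranch-node (d ∷ ps) fits βy
      }

  untagged : Vertex → Vertex × Dir
  untagged v = v , 0F

  vertices-untagged : ∀ vs → vertices (map untagged vs) ≡ vs
  vertices-untagged vs = trans (sym (map-∘ vs)) (map-id vs)

  module Fork {r} (ps : Address) (fits : length ps + suc r < k) (p : Vertex) (p∈ : InBranch ps p) where

    child-fits : ∀ d → length (d ∷ ps) + r < k
    child-fits d = subst (_< k) (+-suc (length ps) r) fits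

    edge : ∀ d → ChildEdge ps d
    edge d = childEdge ps d (≤-trans (s≤s (s≤s (m≤m+n (length ps) r))) (child-fits d))

    open Tripod (tripod {target = ChildEdge.exit ∘ edge} (InBranch-connected ps) p∈ (ChildEdge.exit∈ ∘ edge)) public

    block : Dir → List (Vertex × Dir)
    block d = map untagged stem ++ (centre , d) ∷ map untagged (arm d)

    vertices-arm : ∀ d xs → vertices (map untagged (arm d) ++ xs) ≡ arm d ++ vertices xs
    vertices-arm d xs =
      trans (map-++ proj₁ (map untagged (arm d)) xs) (cong (_++ vertices xs) (vertices-untagged (arm d)))

    vertices-block : ∀ d xs → vertices (block d ++ xs) ≡ (stem ++ centre ∷ arm d) ++ vertices xs
    vertices-block d xs = trans (map-++ proj₁ (block d) xs) (cong (_++ vertices xs) (begin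
      vertices (map untagged stem ++ (centre , d) ∷ map untagged (arm d))
        ≡⟨ map-++ proj₁ (map untagged stem) _ ⟩
      vertices (map untagged stem) ++ centre ∷ vertices (map untagged (arm d))
        ≡⟨ cong₂ (λ s t → s ++ centre ∷ t) (vertices-untagged stem) (vertices-untagged (arm d)) ⟩
      stem ++ centre ∷ arm d ∎))
      where open ≡-Reasoning

    prepend-block : ∀ d {e vs} → SimplePathIn (InSubtree (d ∷ ps)) (ChildEdge.entry (edge d)) e vs →
                 SimplePathIn (InSubtree ps) p e ((stem ++ centre ∷ arm d) ++ vs)
    prepend-block d π = record
      { walk   = append (walk d) (ChildEdge.adjacent (edge d)) (SimplePathIn.walk π)
      ; unique = Unique.++⁺ (unique d) (SimplePathIn.unique π) λ (v∈block , v∈rest) →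
                   InBranch⇒∉child-subtree (inside d v∈block) (SimplePathIn.inside π v∈rest)
      ; inside = [ InBranch⇒InSubtree ∘ inside d , InSubtree-parent ∘ SimplePathIn.inside π ]′
                 ∘ ∈-++⁻ (stem ++ centre ∷ arm d)
      }

  treeWalk : ∀ {r} ps → length ps + r < k → ∀ p → InBranch ps p → Vec Dir (suc r) → List (Vertex × Dir)
  treeWalk {zero}  ps fits p p∈ (d ∷ []) = [ p , d ]
  treeWalk {suc r} ps fits p p∈ (d ∷ ds) =
    block d ++ treeWalk (d ∷ ps) (child-fits d) (ChildEdge.entry (edge d)) (ChildEdge.entry∈ (edge d)) ds
    where open Fork ps fits p p∈

  treeWalk-SimplePathIn : ∀ {r} ps fits p p∈ (ds : Vec Dir (suc r)) →
                    ∃ λ e → SimplePathIn (InSubtree ps) p e (vertices (treeWalk ps fits p p∈ ds))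
  treeWalk-SimplePathIn {zero} ps fits p p∈ (d ∷ []) =
    p , record { walk = trivial ; unique = [] ∷ [] ; inside = λ { (here refl) → InBranch⇒InSubtree p∈ } }
  treeWalk-SimplePathIn {suc r} ps fits p p∈ (d ∷ ds) =
    let e , π = treeWalk-SimplePathIn (d ∷ ps) (child-fits d) _ (ChildEdge.entry∈ (edge d)) ds
    in e , subst (SimplePathIn (InSubtree ps) p e) (sym (vertices-block d _)) (prepend-block d π)
    where open Fork ps fits p p∈

  record Divergence (xs ys : List (Vertex × Dir)) : Set where
    field
      common   : List (Vertex × Dir)
      centre   : Vertex
      tag tag′ : Dir
      rest rest′ : List (Vertex × Dir)
      split    : xs ≡ common ++ (centre , tag) ∷ rest
      split′   : ys ≡ common ++ (centre , tag′) ∷ rest′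
      tag≢tag′ : ¬ tag ≡ tag′
      path     : IsPath G (reverse (vertices rest) ++ centre ∷ vertices rest′)

  Divergence-prepend : ∀ zs {xs ys} → Divergence xs ys → Divergence (zs ++ xs) (zs ++ ys)
  Divergence-prepend zs D = record
    { common = zs ++ common ; centre = centre ; tag = tag ; tag′ = tag′ ; rest = rest ; rest′ = rest′
    ; split    = trans (cong (zs ++_) split) (sym (++-assoc zs common _))
    ; split′   = trans (cong (zs ++_) split′) (sym (++-assoc zs common _))
    ; tag≢tag′ = tag≢tag′
    ; path     = path
    }
    where open Divergence D

  module _ {r} (ps : Address) (fits : length ps + suc r < k) (p : Vertex) (p∈ : InBranch ps p) where
    open Fork ps fits p p∈

    childWalk : Dir → Vec Dir (suc r) → List (Vertex × Dir)
    childWalk d = treeWalk (d ∷ ps) (child-fits d) (ChildEdge.entry (edge d)) (ChildEdge.entry∈ (edge d))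

    afterCentre : Dir → Vec Dir (suc r) → List Vertex
    afterCentre d ds = arm d ++ vertices (childWalk d ds)

    afterCentre-simple : ∀ d ds →
                         ∃ λ e → Walk centre e (centre ∷ afterCentre d ds) × Unique (centre ∷ afterCentre d ds)
    afterCentre-simple d ds with treeWalk-SimplePathIn ps fits p p∈ (d ∷ ds)
    ... | e , π = e , suffix stem walk′ , Unique-++⁻ʳ stem unique′
      where
      open SimplePathIn (subst (SimplePathIn (InSubtree ps) p e)
                                 (trans (vertices-block d _) (++-assoc stem (centre ∷ arm d) _)) π)
        renaming (walk to walk′; unique to unique′)

    arm-inside : ∀ d {v} → v ∈ arm d → InBranch ps v
    arm-inside d v∈ = inside d (∈-++⁺ʳ stem (there v∈))

    afterCentre-inside : ∀ d ds {v} → v ∈ afterCentre d ds → v ∈ arm d ⊎ InSubtree (d ∷ ps) v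
    afterCentre-inside d ds v∈ with ∈-++⁻ (arm d) v∈
    ... | inj₁ v∈arm  = inj₁ v∈arm
    ... | inj₂ v∈rest = inj₂ (SimplePathIn.inside (proj₂ (treeWalk-SimplePathIn (d ∷ ps) _ _ _ ds)) v∈rest)

    afterCentre-disjoint : ∀ {d d′} ds ds′ → ¬ d ≡ d′ → Disjoint (afterCentre d ds) (afterCentre d′ ds′)
    afterCentre-disjoint {d} {d′} ds ds′ d≢d′ (v∈ , v∈′)
      with afterCentre-inside d ds v∈ | afterCentre-inside d′ ds′ v∈′
    ... | inj₁ v∈arm | inj₁ v∈arm′ = arms-disjoint d≢d′ (v∈arm , v∈arm′)
    ... | inj₁ v∈arm | inj₂ v∈sub′ = InBranch⇒∉child-subtree (arm-inside d v∈arm) v∈sub′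
    ... | inj₂ v∈sub | inj₁ v∈arm′ = InBranch⇒∉child-subtree (arm-inside d′ v∈arm′) v∈sub
    ... | inj₂ v∈sub | inj₂ v∈sub′ = child-subtrees-disjoint d≢d′ v∈sub v∈sub′

    fork-Divergence : ∀ {d d′} ds ds′ → ¬ d ≡ d′ →
                      Divergence (block d ++ childWalk d ds) (block d′ ++ childWalk d′ ds′)
    fork-Divergence {d} {d′} ds ds′ d≢d′ with afterCentre-simple d ds | afterCentre-simple d′ ds′
    ... | _ , w , u | _ , w′ , u′ = record
      { common = map untagged stem ; centre = centre ; tag = d ; tag′ = d′
      ; rest = map untagged (arm d) ++ childWalk d ds ; rest′ = map untagged (arm d′) ++ childWalk d′ ds′
      ; split = ++-assoc (map untagged stem) _ _ ; split′ = ++-assoc (map untagged stem) _ _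
      ; tag≢tag′ = d≢d′
      ; path = subst₂ (λ xs ys → IsPath G (reverse xs ++ centre ∷ ys))
                 (sym (vertices-arm d _)) (sym (vertices-arm d′ _))
                 (fork-IsPath w w′ u u′ (afterCentre-disjoint ds ds′ d≢d′))
      }

  treeWalk-diverge : ∀ {r} ps fits p p∈ (ds es : Vec Dir (suc r)) → ¬ ds ≡ es →
                     Divergence (treeWalk ps fits p p∈ ds) (treeWalk ps fits p p∈ es)
  treeWalk-diverge {zero} ps fits p p∈ (d ∷ []) (e ∷ []) ds≢es = record
    { common = [] ; centre = p ; tag = d ; tag′ = e ; rest = [] ; rest′ = []
    ; split = refl ; split′ = refl ; tag≢tag′ = ds≢es ∘ cong (_∷ [])
    ; path = Walk⇒IsPath trivial ([] ∷ [])
    }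
  treeWalk-diverge {suc r} ps fits p p∈ (d ∷ ds) (e ∷ es) ds≢es with d ≟ᶠ e
  ... | yes refl = Divergence-prepend (block d)
                     (treeWalk-diverge (d ∷ ps) (child-fits d) _ _ ds es (ds≢es ∘ cong (d ∷_)))
    where open Fork ps fits p p∈
  ... | no d≢e = fork-Divergence ps fits p p∈ ds es d≢e

funToFin-cong : ∀ {a m} {f g : Fin a → Fin m} → f ≗ g → funToFin f ≡ funToFin g
funToFin-cong {zero}  f≗g = refl
funToFin-cong {suc a} f≗g = cong₂ combine (f≗g 0F) (funToFin-cong (f≗g ∘ Fin.suc))

≗-injective⇒^≤^ : ∀ {m a b n} (F : Vec (Fin m) a → (Fin b → Fin n)) →
                  (∀ xs ys → F xs ≗ F ys → xs ≡ ys) → m ^ a ≤ n ^ b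
≗-injective⇒^≤^ {m} {a} {b} {n} F F-injective = injective⇒≤ {f = encode} encode-injective
  where
  encode : Fin (m ^ a) → Fin (n ^ b)
  encode i = funToFin (F (tabulate (finToFun {m} {a} i)))

  encode-injective : ∀ {i j} → encode i ≡ encode j → i ≡ j
  encode-injective {i} {j} eq = begin
    i                             ≡⟨ funToFin-finToFin {a} {m} i ⟨
    funToFin (finToFun {m} {a} i) ≡⟨ funToFin-cong {a} {m} finToFun-i≗j ⟩
    funToFin (finToFun {m} {a} j) ≡⟨ funToFin-finToFin {a} {m} j ⟩
    j                             ∎
    where
    open ≡-Reasoning
    same-F : F (tabulate (finToFun i)) ≗ F (tabulate (finToFun j))
    same-F β = trans (sym (finToFun-funToFin {b} {n} _ β))
                     (trans (cong (λ q → finToFun {n} {b} q β) eq) (finToFun-funToFin {b} {n} _ β))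
    finToFun-i≗j : finToFun {m} {a} i ≗ finToFun j
    finToFun-i≗j t = begin
      finToFun i t                        ≡⟨ lookup∘tabulate (finToFun i) t ⟨
      lookup (tabulate (finToFun i)) t    ≡⟨ cong (λ xs → lookup xs t) (F-injective _ _ same-F) ⟩
      lookup (tabulate (finToFun j)) t    ≡⟨ lookup∘tabulate (finToFun j) t ⟩
      finToFun j t                        ∎

module Signature (G : Graph) (r : ℕ) (M : MinorModel (B (suc r)) G)
                 {χ : ℕ} (c : Fin (n G) → Fin χ) (linear : IsLinearColoring G χ c) where
  open Walks G
  open Branches G (suc r) M
  open Residues G c

  root : ∃ (InBranch [])
  root with MinorModel.nonempty M (node [] (s≤s z≤n))
  ... | x , βx = x , InBranch-node [] (s≤s z≤n) βx

  rootWalk : Vec Dir (suc r) → List (Vertex × Dir)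
  rootWalk = treeWalk [] ≤-refl (proj₁ root) (proj₂ root)

  signature : Vec Dir (suc r) → Fin χ → Fin 3
  signature ds β = tally β (rootWalk ds) mod 3

  toℕ-signature : ∀ ds β → toℕ (signature ds β) ≡ residue β (rootWalk ds)
  toℕ-signature ds β = toℕ-fromℕ< _

  signature-separates : ∀ ds es → ¬ ds ≡ es → ∃ λ β → ¬ signature ds β ≡ signature es β
  signature-separates ds es ds≢es = β , λ eq → differ (residue-cancelˡ β common _ _ (begin
    residue β (common ++ (centre , tag) ∷ rest)   ≡⟨ cong (residue β) split ⟨
    residue β (rootWalk ds)                       ≡⟨ toℕ-signature ds β ⟨
    toℕ (signature ds β)                          ≡⟨ cong toℕ eq ⟩
    toℕ (signature es β)                          ≡⟨ toℕ-signature es β ⟩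
    residue β (rootWalk es)                       ≡⟨ cong (residue β) split′ ⟩
    residue β (common ++ (centre , tag′) ∷ rest′) ∎))
    where
    open ≡-Reasoning
    open Divergence (treeWalk-diverge [] ≤-refl (proj₁ root) (proj₂ root) ds es ds≢es)
    separation = linear-coloring-separates linear rest rest′ tag≢tag′ path
    β = proj₁ separation
    differ = proj₂ separation

  signature-injective : ∀ ds es → signature ds ≗ signature es → ds ≡ es
  signature-injective ds es same with ≡-dec _≟ᶠ_ ds es
  ... | yes ds≡es = ds≡es
  ... | no ds≢es  = let β , differ = signature-separates ds es ds≢es in contradiction (same β) differ

lemma2p10 : (k : ℕ) → .{{_ : NonZero k}} → (G : Graph) → IsMinorOf (B k) G →
    (χ : ℕ) → IsLinChromaticNumber G χ → 2 ^ k ≤ 3 ^ χ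
lemma2p10 zero    G M χ _                  = m^n>0 3 χ
lemma2p10 (suc r) G M χ ((c , linear) , _) = ≗-injective⇒^≤^ signature signature-injective
  where open Signature G r M c linear
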